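{- For all integers $n,k$ with $n\equiv 2\pmod 4$, $n\geq 6$, $k\equiv 1\pmod 4$ and $5\leq k<n$, there exists a Heffter array $H(n;k)$.
   Context: A Heffter array $H(n;k)$ is an $n\times n$ array, some of whose cells are filled with integers, such that: each row and each column contains exactly $k$ filled cells; every row sum and column sum is congruent to $0$ modulo $2nk+1$; and for each integer $1\leq x\leq nk$, either $x$ or $-x$ appears in the array. -}

module Defs where

open import Data.Nat using (ℕ; suc; _*_; _+_; _≤_; _<_)
open import Data.Integer as ℤ using (ℤ; +_; -_)
open import Data.Integer.Divisibility using () renaming (_∣_ to _∣ℤ_)
open import Data.Fin using (Fin)
open import Data.List using (List; length; filter; map; sum; allFin)
open import Data.Maybe using (Maybe; just; nothing; is-just; fromMaybe)
open import Data.Bool using (T)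
open import Data.Product using (Σ; _×_; ∃; ∃-syntax; _,_)
open import Data.Sum using (_⊎_)
open import Relation.Binary.PropositionalEquality using (_≡_)
open import Relation.Nullary.Decidable using (Dec)
open import Data.Unit using (⊤)

PartialArray : ℕ → Set
PartialArray n = Fin n → Fin n → Maybe ℤ

filledCount : ∀ {n} → (Fin n → Maybe ℤ) → ℕ
filledCount {n} f = length (filter (λ i → Data.Bool.T? (is-just (f i))) (allFin n))
  where import Data.Bool

lineSum : ∀ {n} → (Fin n → Maybe ℤ) → ℤ
lineSum {n} f = Data.List.foldr ℤ._+_ (+ 0) (map (λ i → fromMaybe (+ 0) (f i)) (allFin n))
  where import Data.List

row : ∀ {n} → PartialArray n → Fin n → (Fin n → Maybe ℤ)
row A i = λ j → A i j

col : ∀ {n} → PartialArray n → Fin n → (Fin n → Maybe ℤ)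
col A j = λ i → A i j

record IsHeffter (n k : ℕ) (A : PartialArray n) : Set where
  field
    rowFilled : ∀ i → filledCount (row A i) ≡ k
    colFilled : ∀ j → filledCount (col A j) ≡ k
    rowSum    : ∀ i → (+ (2 * n * k + 1)) ∣ℤ lineSum (row A i)
    colSum    : ∀ j → (+ (2 * n * k + 1)) ∣ℤ lineSum (col A j)
    covers    : ∀ (x : ℕ) → 1 ≤ x → x ≤ n * k →
                ∃[ i ] ∃[ j ] (A i j ≡ just (+ x) ⊎ A i j ≡ just (- (+ x)))

HeffterArray : ℕ → ℕ → Set
HeffterArray n k = Σ (PartialArray n) (IsHeffter n k)

-- Write n = 2h and k = 4m + 5, so that h ≥ 2m + 3.  Grouping rows and columns in pairs, the array is an
-- h × h array of 2 × 2 blocks, and the block in block row r and block column c depends only on r and on its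
-- diagonal d = c − r (mod h).  The blocks on diagonals 0, 1 and 2 are affine in r and take the values
-- ±[1, 6h] and ±[nk − 4h + 1, nk]; they contribute 2nk + 1 to one line of each row pair and column pair
-- and 0 to the other.  Diagonal 3 + e, for e < 2m, holds [[x, −(x+1)], [−(x+2), x+3]] when e is even and
-- [[x+3, −(x+2)], [−(x+1), x]] when e is odd, where x = 6h + 4(r + eh) + 1; these fill ±[6h + 1, nk − 4h]
-- four values at a time, and as the two kinds of block have opposite row and column sums, each pair of
-- consecutive band diagonals contributes 0 to every line.  Summing along a row of blocks is a cyclic
-- rotation of the diagonal index, and along a column of blocks a reflection.

module Submission where

open import Defs
open import Data.Nat using (ℕ; _%_; _≤_; _<_)
open import Algebra.Structures using (IsCommutativeMonoid)
open import Relation.Binary.PropositionalEquality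
open import Data.Parity.Base using (Parity; 0ℙ; 1ℙ)
open import Data.Product using (∃-syntax; _,_)
open import Data.Sum as Sum using (_⊎_; inj₁; inj₂)
open import Function using (_∘_)

module Remainders where

  open import Data.Nat using (_+_; _*_; NonZero)
  open import Data.Nat.DivMod

  %-absorbˡ : ∀ a b n .{{_ : NonZero n}} → (a % n + b) % n ≡ (a + b) % n
  %-absorbˡ a b n = begin
    (a % n + b) % n           ≡⟨ %-distribˡ-+ (a % n) b n ⟩
    (a % n % n + b % n) % n   ≡⟨ cong (λ x → (x + b % n) % n) (m%n%n≡m%n a n) ⟩
    (a % n + b % n) % n       ≡⟨ %-distribˡ-+ a b n ⟨
    (a + b) % n               ∎
    where open ≡-Reasoning

  a≡d+qn⇒a%n≡d : ∀ {a d} q n .{{_ : NonZero n}} → a ≡ d + q * n → d < n → a % n ≡ d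
  a≡d+qn⇒a%n≡d {d = d} q n refl d<n = trans ([m+kn]%n≡m%n d q n) (m<n⇒m%n≡m d<n)

module FiniteSum {A : Set} {_∙_ : A → A → A} {ε : A}
                 (isCommutativeMonoid : IsCommutativeMonoid _≡_ _∙_ ε) where

  open import Data.Nat using (zero; suc; _+_; _∸_; z≤n; s≤s; NonZero)
  open import Data.Nat.Properties
  open import Data.Nat.DivMod
  open import Data.Fin using (toℕ)
  open import Data.List using (foldr; tabulate)
  open Remainders

  open IsCommutativeMonoid isCommutativeMonoid using (assoc; comm; identityˡ; identityʳ)

  ∑ : ℕ → (ℕ → A) → A
  ∑ zero    f = ε
  ∑ (suc n) f = f 0 ∙ ∑ n (f ∘ suc)

  ∑-cong : ∀ n {f g : ℕ → A} → (∀ i → i < n → f i ≡ g i) → ∑ n f ≡ ∑ n g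
  ∑-cong zero    f≗g = refl
  ∑-cong (suc n) f≗g = cong₂ _∙_ (f≗g 0 (s≤s z≤n)) (∑-cong n (λ i i<n → f≗g (suc i) (s≤s i<n)))

  ∑-ε : ∀ n {f : ℕ → A} → (∀ i → i < n → f i ≡ ε) → ∑ n f ≡ ε
  ∑-ε n f≗ε = trans (∑-cong n f≗ε) (ε-sum n)
    where
    ε-sum : ∀ n → ∑ n (λ _ → ε) ≡ ε
    ε-sum zero    = refl
    ε-sum (suc n) = trans (cong (ε ∙_) (ε-sum n)) (identityˡ ε)

  ∑-+ : ∀ m n f → ∑ (m + n) f ≡ ∑ m f ∙ ∑ n (λ i → f (m + i))
  ∑-+ zero    n f = sym (identityˡ _)
  ∑-+ (suc m) n f = trans (cong (f 0 ∙_) (∑-+ m n (f ∘ suc))) (sym (assoc _ _ _))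

  ∑-pairs : ∀ n f → ∑ (n + n) f ≡ ∑ n (λ i → f (i + i) ∙ f (suc (i + i)))
  ∑-pairs zero    f = refl
  ∑-pairs (suc n) f = begin
    f 0 ∙ ∑ (n + suc n) (f ∘ suc)            ≡⟨ cong (λ l → f 0 ∙ ∑ l (f ∘ suc)) (+-suc n n) ⟩
    f 0 ∙ (f 1 ∙ ∑ (n + n) (f ∘ suc ∘ suc))  ≡⟨ assoc _ _ _ ⟨
    (f 0 ∙ f 1) ∙ ∑ (n + n) (f ∘ suc ∘ suc)
      ≡⟨ cong ((f 0 ∙ f 1) ∙_) (∑-pairs n (f ∘ suc ∘ suc)) ⟩
    (f 0 ∙ f 1) ∙ ∑ n (λ i → f (2 + (i + i)) ∙ f (3 + (i + i)))
      ≡⟨ cong ((f 0 ∙ f 1) ∙_) (∑-cong n (λ i _ → cong₂ (λ a b → f a ∙ f b)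
                                 (cong suc (+-suc i i)) (cong (2 +_) (+-suc i i)))) ⟨
    ∑ (suc n) (λ i → f (i + i) ∙ f (suc (i + i)))  ∎
    where open ≡-Reasoning

  ∑-snoc : ∀ n f → ∑ (suc n) f ≡ ∑ n f ∙ f n
  ∑-snoc zero    f = trans (identityʳ (f 0)) (sym (identityˡ (f 0)))
  ∑-snoc (suc n) f = trans (cong (f 0 ∙_) (∑-snoc n (f ∘ suc))) (sym (assoc _ _ _))

  ∑-reverse : ∀ n f → ∑ n f ≡ ∑ n (λ i → f (n ∸ suc i))
  ∑-reverse zero    f = refl
  ∑-reverse (suc n) f = begin
    f 0 ∙ ∑ n (f ∘ suc)                          ≡⟨ cong (f 0 ∙_) (∑-reverse n (f ∘ suc)) ⟩
    f 0 ∙ ∑ n (λ i → f (suc (n ∸ suc i)))        ≡⟨ comm _ _ ⟩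
    ∑ n (λ i → f (suc (n ∸ suc i))) ∙ f 0
      ≡⟨ cong₂ _∙_ (∑-cong n (λ i i<n → cong f (sym (+-∸-assoc 1 i<n))))
                   (cong f (sym (n∸n≡0 n))) ⟩
    ∑ n (λ i → f (suc n ∸ suc i)) ∙ f (suc n ∸ suc n)  ≡⟨ ∑-snoc n _ ⟨
    ∑ (suc n) (λ i → f (suc n ∸ suc i))          ∎
    where open ≡-Reasoning

  ∑-rotate : ∀ n .{{_ : NonZero n}} s f → ∑ n (λ i → f ((i + s) % n)) ≡ ∑ n f
  ∑-rotate n@(suc n-1) zero    f =
    ∑-cong n (λ i i<n → cong f (trans (cong (_% n) (+-identityʳ i)) (m<n⇒m%n≡m i<n)))
  ∑-rotate n@(suc n-1) (suc s) f = begin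
    ∑ n (λ i → f ((i + suc s) % n))        ≡⟨ ∑-cong n (λ i _ → cong f (trans (cong (_% n) (+-suc i s))
                                                                        (sym (%-absorbˡ (suc i) s n)))) ⟩
    ∑ n (λ i → g (suc i % n))              ≡⟨ ∑-snoc n-1 _ ⟩
    ∑ n-1 (λ i → g (suc i % n)) ∙ g (n % n)
      ≡⟨ cong₂ _∙_ (∑-cong n-1 (λ i i<n → cong g (m<n⇒m%n≡m (s≤s i<n)))) (cong g (n%n≡0 n)) ⟩
    ∑ n-1 (g ∘ suc) ∙ g 0                  ≡⟨ comm _ _ ⟩
    ∑ n g                                  ≡⟨ ∑-rotate n s f ⟩
    ∑ n f                                  ∎
    where
    open ≡-Reasoning
    g : ℕ → A
    g x = f ((x + s) % n)

  ∑-reflect : ∀ n .{{_ : NonZero n}} s f → ∑ n (λ i → f ((s + (n ∸ i)) % n)) ≡ ∑ n f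
  ∑-reflect n@(suc n-1) s f = begin
    ∑ n (λ i → f ((s + (n ∸ i)) % n))          ≡⟨ ∑-reverse n (λ i → f ((s + (n ∸ i)) % n)) ⟩
    ∑ n (λ i → f ((s + (n ∸ (n ∸ suc i))) % n))
      ≡⟨ ∑-cong n (λ i i<n → cong (λ j → f ((s + j) % n)) (m∸[m∸n]≡n i<n)) ⟩
    ∑ n (λ i → f ((s + suc i) % n))
      ≡⟨ ∑-cong n (λ i _ → cong (λ j → f (j % n)) (trans (+-suc s i) (+-comm (suc s) i))) ⟩
    ∑ n (λ i → f ((i + suc s) % n))            ≡⟨ ∑-rotate n (suc s) f ⟩
    ∑ n f                                      ∎
    where open ≡-Reasoning

  foldr-tabulate : ∀ n (g : ℕ → A) → foldr _∙_ ε (tabulate {n = n} (g ∘ toℕ)) ≡ ∑ n g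
  foldr-tabulate zero    g = refl
  foldr-tabulate (suc n) g = cong (g 0 ∙_) (foldr-tabulate n (g ∘ suc))

module Halving where

  open import Data.Nat using (zero; suc; _+_; ⌊_/2⌋; parity)
  open import Data.Nat.Properties

  unhalve : Parity → ℕ → ℕ
  unhalve 0ℙ c = c + c
  unhalve 1ℙ c = suc (c + c)

  unhalve-suc : ∀ i c → unhalve i (suc c) ≡ suc (suc (unhalve i c))
  unhalve-suc 0ℙ c = cong suc (+-suc c c)
  unhalve-suc 1ℙ c = cong (suc ∘ suc) (+-suc c c)

  parity-unhalve : ∀ i c → parity (unhalve i c) ≡ i
  parity-unhalve 0ℙ zero    = refl
  parity-unhalve 1ℙ zero    = refl
  parity-unhalve i  (suc c) = trans (cong parity (unhalve-suc i c)) (parity-unhalve i c)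

  ⌊unhalve/2⌋ : ∀ i c → ⌊ unhalve i c /2⌋ ≡ c
  ⌊unhalve/2⌋ 0ℙ zero    = refl
  ⌊unhalve/2⌋ 1ℙ zero    = refl
  ⌊unhalve/2⌋ i  (suc c) = trans (cong ⌊_/2⌋ (unhalve-suc i c)) (cong suc (⌊unhalve/2⌋ i c))

  unhalve-parity-⌊/2⌋ : ∀ a → unhalve (parity a) ⌊ a /2⌋ ≡ a
  unhalve-parity-⌊/2⌋ zero          = refl
  unhalve-parity-⌊/2⌋ (suc zero)    = refl
  unhalve-parity-⌊/2⌋ (suc (suc a)) =
    trans (unhalve-suc (parity a) ⌊ a /2⌋) (cong (suc ∘ suc) (unhalve-parity-⌊/2⌋ a))

  unhalve-< : ∀ i {c h} → c < h → unhalve i c < h + h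
  unhalve-< 0ℙ c<h = +-mono-< c<h c<h
  unhalve-< 1ℙ {c} {h} c<h = subst (_≤ h + h) (cong suc (+-suc c c)) (+-mono-≤ c<h c<h)

  double≤unhalve : ∀ i c → c + c ≤ unhalve i c
  double≤unhalve 0ℙ c = ≤-refl
  double≤unhalve 1ℙ c = n≤1+n (c + c)

  ⌊/2⌋-< : ∀ {a h} → a < h + h → ⌊ a /2⌋ < h
  ⌊/2⌋-< {a} {h} a<2h = ≰⇒> λ h≤a/2 → <⇒≱ a<2h (begin
    h + h                                 ≤⟨ +-mono-≤ h≤a/2 h≤a/2 ⟩
    ⌊ a /2⌋ + ⌊ a /2⌋                     ≤⟨ double≤unhalve (parity a) ⌊ a /2⌋ ⟩
    unhalve (parity a) ⌊ a /2⌋            ≡⟨ unhalve-parity-⌊/2⌋ a ⟩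
    a                                     ∎)
    where open ≤-Reasoning

module Cyclic (h-1 : ℕ) where

  open import Data.Nat using (suc; _+_; _*_; _∸_; _/_)
  open import Data.Nat.Properties
  open import Data.Nat.DivMod
  open Remainders

  h : ℕ
  h = suc h-1

  _⊖_ : ℕ → ℕ → ℕ
  c ⊖ r = (c + (h ∸ r)) % h

  ⊖-cancel : ∀ {r d} → r ≤ h → d < h → ((r + d) % h) ⊖ r ≡ d
  ⊖-cancel {r} {d} r≤h d<h = begin
    ((r + d) % h + (h ∸ r)) % h    ≡⟨ %-absorbˡ (r + d) (h ∸ r) h ⟩
    (r + d + (h ∸ r)) % h          ≡⟨ a≡d+qn⇒a%n≡d 1 h eq d<h ⟩
    d                              ∎
    where
    open ≡-Reasoning
    eq : r + d + (h ∸ r) ≡ d + 1 * h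
    eq = begin
      r + d + (h ∸ r)      ≡⟨ cong (_+ (h ∸ r)) (+-comm r d) ⟩
      d + r + (h ∸ r)      ≡⟨ +-assoc d r (h ∸ r) ⟩
      d + (r + (h ∸ r))    ≡⟨ cong (d +_) (m+[n∸m]≡n r≤h) ⟩
      d + h                ≡⟨ cong (d +_) (+-identityʳ h) ⟨
      d + 1 * h            ∎

  ⊖-involutive : ∀ c {d} → d < h → c ⊖ (c ⊖ d) ≡ d
  ⊖-involutive c {d} d<h = a≡d+qn⇒a%n≡d q h (+-cancelʳ-≡ x _ _ eq) d<h
    where
    open ≡-Reasoning
    y = c + (h ∸ d)
    x = y % h
    q = y / h
    eq : c + (h ∸ x) + x ≡ d + q * h + x
    eq = begin
      c + (h ∸ x) + x      ≡⟨ +-assoc c (h ∸ x) x ⟩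
      c + (h ∸ x + x)      ≡⟨ cong (c +_) (m∸n+n≡m (<⇒≤ (m%n<n y h))) ⟩
      c + h                ≡⟨ cong (c +_) (m∸n+n≡m (<⇒≤ d<h)) ⟨
      c + (h ∸ d + d)      ≡⟨ +-assoc c (h ∸ d) d ⟨
      y + d                ≡⟨ cong (_+ d) (m≡m%n+[m/n]*n y h) ⟩
      x + q * h + d        ≡⟨ +-comm (x + q * h) d ⟩
      d + (x + q * h)      ≡⟨ cong (d +_) (+-comm x (q * h)) ⟩
      d + (q * h + x)      ≡⟨ +-assoc d (q * h) x ⟨
      d + q * h + x        ∎

  ⊖-suc : ∀ c {i} → i < h → (c ⊖ i) ⊖ 1 ≡ c ⊖ suc i
  ⊖-suc c {i} i<h = begin
    ((c + (h ∸ i)) % h + h-1) % h    ≡⟨ %-absorbˡ (c + (h ∸ i)) h-1 h ⟩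
    (c + (h ∸ i) + h-1) % h          ≡⟨ cong (λ j → (c + j + h-1) % h) (+-∸-assoc 1 i<h) ⟩
    (c + suc (h ∸ suc i) + h-1) % h  ≡⟨ cong (λ j → (j + h-1) % h) (+-suc c (h ∸ suc i)) ⟩
    (suc (c + (h ∸ suc i)) + h-1) % h ≡⟨ cong (_% h) (+-suc (c + (h ∸ suc i)) h-1) ⟨
    (c + (h ∸ suc i) + h) % h        ≡⟨ [m+n]%n≡m%n (c + (h ∸ suc i)) h ⟩
    c ⊖ suc i                        ∎
    where open ≡-Reasoning

module Intervals (P : ℕ → Set) where

  open import Data.Nat using (suc; _+_; _∸_; _≤?_)
  open import Data.Nat.Properties
  open import Relation.Nullary using (yes; no)

  Covered : ℕ → ℕ → Set
  Covered lo hi = ∀ x → lo < x → x ≤ hi → P x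

  infixr 5 _++_

  _++_ : ∀ {lo mid hi} → Covered lo mid → Covered mid hi → Covered lo hi
  _++_ {mid = mid} below above x lo<x x≤hi with x ≤? mid
  ... | yes x≤mid = below x lo<x x≤mid
  ... | no  x≰mid = above x (≰⇒> x≰mid) x≤hi

  covered-ascending : ∀ {lo w hi} → lo + w ≡ hi →
                      (∀ z → z < w → P (suc (lo + z))) → Covered lo hi
  covered-ascending {lo} {w} refl P-at x lo<x x≤hi = subst P x≡ (P-at z z<w)
    where
    z = x ∸ suc lo
    x≡ : suc (lo + z) ≡ x
    x≡ = m+[n∸m]≡n lo<x
    z<w : z < w
    z<w = +-cancelˡ-≤ lo (suc z) w (subst (_≤ lo + w) (trans (sym x≡) (sym (+-suc lo z))) x≤hi)

  covered-descending : ∀ {lo w hi} → lo + w ≡ hi →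
                       (∀ x z → z < w → x + z ≡ hi → P x) → Covered lo hi
  covered-descending {lo} {w} refl P-at x lo<x x≤hi = P-at x z z<w x+z≡
    where
    z = lo + w ∸ x
    x+z≡ : x + z ≡ lo + w
    x+z≡ = m+[n∸m]≡n x≤hi
    z<w : z < w
    z<w = +-cancelˡ-≤ lo (suc z) w (begin
      lo + suc z  ≡⟨ +-suc lo z ⟩
      suc lo + z  ≤⟨ +-monoˡ-≤ z lo<x ⟩
      x + z       ≡⟨ x+z≡ ⟩
      lo + w      ∎)
      where open ≤-Reasoning

module BlockArithmetic where

  open import Data.Integer using (ℤ; +_; -_; _+_; _-_; _*_)
  open import Data.Integer.Tactic.RingSolver using (solve-∀; solve)
  import Data.Nat as ℕ
  open import Data.Nat.Properties using (+-identityʳ)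
  open import Data.List using ([]; _∷_)

  infix 4 _≡±_
  _≡±_ : ℤ → ℕ → Set
  v ≡± x = v ≡ + x ⊎ v ≡ - + x

  minus-cast : ∀ {C B : ℤ} {x b c : ℕ} → C ≡ + c → B ≡ + b → x ℕ.+ b ≡ c → C - B ≡ + x
  minus-cast {x = x} {b} refl refl refl = cancel (+ x) (+ b)
    where
    cancel : ∀ X B → (X + B) - B ≡ X
    cancel = solve-∀

  pairBlock : Parity → Parity → Parity → ℕ → ℤ
  pairBlock 0ℙ 0ℙ 0ℙ x = + x
  pairBlock 0ℙ 0ℙ 1ℙ x = - (+ x + + 1)
  pairBlock 0ℙ 1ℙ 0ℙ x = - (+ x + + 2)
  pairBlock 0ℙ 1ℙ 1ℙ x = + x + + 3
  pairBlock 1ℙ 0ℙ 0ℙ y = + y + + 3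
  pairBlock 1ℙ 0ℙ 1ℙ y = - (+ y + + 2)
  pairBlock 1ℙ 1ℙ 0ℙ y = - (+ y + + 1)
  pairBlock 1ℙ 1ℙ 1ℙ y = + y

  pairBlock-rows-cancel : ∀ i x y →
    (pairBlock 0ℙ i 0ℙ x + pairBlock 0ℙ i 1ℙ x) + (pairBlock 1ℙ i 0ℙ y + pairBlock 1ℙ i 1ℙ y) ≡ + 0
  pairBlock-rows-cancel 0ℙ x y = cancel (+ x) (+ y)
    where
    cancel : ∀ X Y → (X + - (X + + 1)) + ((Y + + 3) + - (Y + + 2)) ≡ + 0
    cancel = solve-∀
  pairBlock-rows-cancel 1ℙ x y = cancel (+ x) (+ y)
    where
    cancel : ∀ X Y → (- (X + + 2) + (X + + 3)) + (- (Y + + 1) + Y) ≡ + 0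
    cancel = solve-∀

  pairBlock-cols-cancel : ∀ j x y →
    (pairBlock 0ℙ 0ℙ j x + pairBlock 0ℙ 1ℙ j x) + (pairBlock 1ℙ 0ℙ j y + pairBlock 1ℙ 1ℙ j y) ≡ + 0
  pairBlock-cols-cancel 0ℙ x y = cancel (+ x) (+ y)
    where
    cancel : ∀ X Y → (X + - (X + + 2)) + ((Y + + 3) + - (Y + + 1)) ≡ + 0
    cancel = solve-∀
  pairBlock-cols-cancel 1ℙ x y = cancel (+ x) (+ y)
    where
    cancel : ∀ X Y → (- (X + + 1) + (X + + 3)) + (- (Y + + 2) + Y) ≡ + 0
    cancel = solve-∀

  pairBlock-covers : ∀ π q x → q ℕ.< 4 → ∃[ i ] ∃[ j ] (pairBlock π i j x ≡± x ℕ.+ q)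
  pairBlock-covers 0ℙ 0 x _ = 0ℙ , 0ℙ , inj₁ (cong +_ (sym (+-identityʳ x)))
  pairBlock-covers 0ℙ 1 x _ = 0ℙ , 1ℙ , inj₂ refl
  pairBlock-covers 0ℙ 2 x _ = 1ℙ , 0ℙ , inj₂ refl
  pairBlock-covers 0ℙ 3 x _ = 1ℙ , 1ℙ , inj₁ refl
  pairBlock-covers 1ℙ 0 y _ = 1ℙ , 1ℙ , inj₁ (cong +_ (sym (+-identityʳ y)))
  pairBlock-covers 1ℙ 1 y _ = 1ℙ , 0ℙ , inj₂ refl
  pairBlock-covers 1ℙ 2 y _ = 0ℙ , 1ℙ , inj₂ refl
  pairBlock-covers 1ℙ 3 y _ = 0ℙ , 0ℙ , inj₁ refl
  pairBlock-covers _ (ℕ.suc (ℕ.suc (ℕ.suc (ℕ.suc _)))) _ (ℕ.s≤s (ℕ.s≤s (ℕ.s≤s (ℕ.s≤s ()))))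

  -- Diagonals 0, 1 and 2 of a line of `Construction.block`, unfolded.  For rows, R is the block row and
  -- U = R − 1; for columns, Rₐ is the block row met on diagonal a and Uₐ = Rₐ − 1.
  row₀-sum : ∀ H T R U →
    (+ 0 + (+ 6 * H - U)) + ((- (+ 4 * H - R) + ((T + + 1 + U) - + 3 * H))
      + ((((T + + 1 + R) - + 2 * H) + (+ 3 * H - (+ 1 + (R + R)))) + + 0)) ≡ + 2 * T + + 1
  row₀-sum = solve-∀

  row₁-sum : ∀ H T R U →
    (- (+ 1 + U) + + 0) + ((- (T - (+ 3 * H + U)) + - (+ 5 * H - R))
      + (((+ 3 * H - (R + R)) + ((T + + 1 + R) - H)) + + 0)) ≡ + 0
  row₁-sum = solve-∀

  col₀-sum : ∀ H T R₁ R₂ {U₀ U₁} → U₀ ≡ R₁ → U₁ ≡ R₂ →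
    (+ 0 + - (+ 1 + U₀)) + ((- (+ 4 * H - R₁) + - (T - (+ 3 * H + U₁)))
      + ((((T + + 1 + R₂) - + 2 * H) + (+ 3 * H - (R₂ + R₂))) + + 0)) ≡ + 0
  col₀-sum H T R₁ R₂ refl refl = solve (H ∷ T ∷ R₁ ∷ R₂ ∷ [])

  col₁-sum : ∀ H T R₁ R₂ {U₀ U₁} → U₀ ≡ R₁ → U₁ ≡ R₂ →
    ((+ 6 * H - U₀) + + 0) + ((((T + + 1 + U₁) - + 3 * H) + - (+ 5 * H - R₁))
      + (((+ 3 * H - (+ 1 + (R₂ + R₂))) + ((T + + 1 + R₂) - H)) + + 0)) ≡ + 2 * T + + 1
  col₁-sum H T R₁ R₂ refl refl = solve (H ∷ T ∷ R₁ ∷ R₂ ∷ [])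

module LineTotals where

  open import Data.Nat using (suc; _+_)
  open import Data.Nat.Properties using (+-0-isCommutativeMonoid)
  open import Data.Integer as ℤ using (ℤ; +_)
  import Data.Integer.Properties as ℤₚ
  open import Data.Fin using (toℕ)
  open import Data.List using ([]; _∷_; length; filter; map; foldr; tabulate; allFin)
  open import Data.List.Properties using (map-tabulate)
  open import Data.Maybe using (Maybe; just; nothing; is-just; fromMaybe)
  open import Data.Bool using (T?)
  open import Function using (id)

  module ℤ∑ = FiniteSum ℤₚ.+-0-isCommutativeMonoid
  module ℕ∑ = FiniteSum +-0-isCommutativeMonoid

  occupied : Maybe ℤ → ℕ
  occupied (just _) = 1
  occupied nothing  = 0

  lineSum-∑ : ∀ n (g : ℕ → Maybe ℤ) → lineSum {n} (g ∘ toℕ) ≡ ℤ∑.∑ n (fromMaybe (+ 0) ∘ g)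
  lineSum-∑ n g = trans (cong (foldr ℤ._+_ (+ 0)) (map-tabulate {n = n} id (fromMaybe (+ 0) ∘ g ∘ toℕ)))
                        (ℤ∑.foldr-tabulate n _)

  length-filter-is-just : ∀ {X : Set} (f : X → Maybe ℤ) xs →
    length (filter (λ x → T? (is-just (f x))) xs) ≡ foldr _+_ 0 (map (occupied ∘ f) xs)
  length-filter-is-just f []       = refl
  length-filter-is-just f (x ∷ xs) with f x
  ... | just _  = cong suc (length-filter-is-just f xs)
  ... | nothing = length-filter-is-just f xs

  filledCount-∑ : ∀ n (g : ℕ → Maybe ℤ) → filledCount {n} (g ∘ toℕ) ≡ ℕ∑.∑ n (occupied ∘ g)
  filledCount-∑ n g = begin
    length (filter (λ j → T? (is-just (g (toℕ j)))) (allFin n))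
      ≡⟨ length-filter-is-just (g ∘ toℕ) (allFin n) ⟩
    foldr _+_ 0 (map (occupied ∘ g ∘ toℕ) (allFin n))
      ≡⟨ cong (foldr _+_ 0) (map-tabulate {n = n} id (occupied ∘ g ∘ toℕ)) ⟩
    foldr _+_ 0 (tabulate {n = n} (occupied ∘ g ∘ toℕ))
      ≡⟨ ℕ∑.foldr-tabulate n _ ⟩
    ℕ∑.∑ n (occupied ∘ g)
      ∎
    where open ≡-Reasoning

module Construction (m s : ℕ) where

  open import Data.Nat using (zero; suc; _+_; _*_; _∸_; _/_; _<?_; z≤n; s≤s; ⌊_/2⌋; parity)
  open import Data.Nat.Properties
  open import Data.Nat.DivMod
  open import Data.Nat.Tactic.RingSolver using (solve-∀)
  import Data.Nat.Divisibility as ℕ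
  open import Data.Integer as ℤ using (ℤ; +_; -_)
  import Data.Integer.Properties as ℤₚ
  open import Data.Integer.Divisibility using () renaming (_∣_ to _∣ℤ_)
  open import Data.Fin using (toℕ; fromℕ<)
  open import Data.Fin.Properties using (toℕ-fromℕ<)
  open import Data.Maybe using (Maybe; just; nothing; fromMaybe)
  open import Relation.Nullary using (yes; no; contradiction)
  open Halving
  open BlockArithmetic
  open LineTotals
  open Cyclic (2 + (m + m) + s)

  n k : ℕ
  n = h + h
  k = 5 + 4 * m

  H T : ℤ
  H = + h
  T = + (n * k)

  prev next : ℕ → ℕ
  prev r = r ⊖ 1
  next u = (1 + u) % h

  bandBase : ℕ → ℕ → ℕ
  bandBase e r = suc (6 * h + (r + e * h) * 4)

  band : ℕ → Parity → Parity → ℕ → Maybe ℤ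
  band e i j r with e <? m + m
  ... | yes _ = just (pairBlock (parity e) i j (bandBase e r))
  ... | no  _ = nothing

  -- Entry (i, j) of the block on diagonal d in block row r.  Entries built from prev r rather than r
  -- cancel, down a column, against those built from r on the next diagonal.
  block : ℕ → Parity → Parity → ℕ → Maybe ℤ
  block 0 0ℙ 0ℙ r = nothing
  block 0 0ℙ 1ℙ r = just (+ 6 ℤ.* H ℤ.- + prev r)
  block 0 1ℙ 0ℙ r = just (- (+ 1 ℤ.+ + prev r))
  block 0 1ℙ 1ℙ r = nothing
  block 1 0ℙ 0ℙ r = just (- (+ 4 ℤ.* H ℤ.- + r))
  block 1 0ℙ 1ℙ r = just ((T ℤ.+ + 1 ℤ.+ + prev r) ℤ.- + 3 ℤ.* H)
  block 1 1ℙ 0ℙ r = just (- (T ℤ.- (+ 3 ℤ.* H ℤ.+ + prev r)))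
  block 1 1ℙ 1ℙ r = just (- (+ 5 ℤ.* H ℤ.- + r))
  block 2 0ℙ 0ℙ r = just ((T ℤ.+ + 1 ℤ.+ + r) ℤ.- + 2 ℤ.* H)
  block 2 0ℙ 1ℙ r = just (+ 3 ℤ.* H ℤ.- (+ 1 ℤ.+ (+ r ℤ.+ + r)))
  block 2 1ℙ 0ℙ r = just (+ 3 ℤ.* H ℤ.- (+ r ℤ.+ + r))
  block 2 1ℙ 1ℙ r = just ((T ℤ.+ + 1 ℤ.+ + r) ℤ.- H)
  block (suc (suc (suc e))) i j r = band e i j r

  entryAt : ℕ → ℕ → Maybe ℤ
  entryAt a b = block (⌊ b /2⌋ ⊖ ⌊ a /2⌋) (parity a) (parity b) ⌊ a /2⌋

  array : PartialArray n
  array a b = entryAt (toℕ a) (toℕ b)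

  band-inside : ∀ {e} i j r → e < m + m → band e i j r ≡ just (pairBlock (parity e) i j (bandBase e r))
  band-inside {e} i j r e<2m with e <? m + m
  ... | yes _   = refl
  ... | no  e≮2m = contradiction e<2m e≮2m

  band-outside : ∀ {e} i j r → m + m ≤ e → band e i j r ≡ nothing
  band-outside {e} i j r 2m≤e with e <? m + m
  ... | yes e<2m = contradiction e<2m (≤⇒≯ 2m≤e)
  ... | no  _    = refl

  module LineProfiles {A : Set} {_∙_ : A → A → A} {ε : A}
                      (isCommutativeMonoid : IsCommutativeMonoid _≡_ _∙_ ε)
                      (φ : Maybe ℤ → A) (φ-nothing : φ nothing ≡ ε) where

    open FiniteSum isCommutativeMonoid
    open IsCommutativeMonoid isCommutativeMonoid using (identityˡ; identityʳ)

    rowProfile colProfile : Parity → ℕ → ℕ → A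
    rowProfile i r d = φ (block d i 0ℙ r) ∙ φ (block d i 1ℙ r)
    colProfile j c d = φ (block d 0ℙ j (c ⊖ d)) ∙ φ (block d 1ℙ j (c ⊖ d))

    pairRow pairCol : Parity → Parity → ℕ → A
    pairRow π i x = φ (just (pairBlock π i 0ℙ x)) ∙ φ (just (pairBlock π i 1ℙ x))
    pairCol π j x = φ (just (pairBlock π 0ℙ j x)) ∙ φ (just (pairBlock π 1ℙ j x))

    row-profile : ∀ a → ∑ n (λ b → φ (entryAt a b)) ≡ ∑ h (rowProfile (parity a) ⌊ a /2⌋)
    row-profile a = begin
      ∑ n (λ b → φ (entryAt a b))                     ≡⟨ ∑-pairs h (λ b → φ (entryAt a b)) ⟩
      ∑ h (λ c → φ (entryAt a (unhalve 0ℙ c)) ∙ φ (entryAt a (unhalve 1ℙ c)))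
        ≡⟨ ∑-cong h (λ c _ → cong₂ _∙_ (cell 0ℙ c) (cell 1ℙ c)) ⟩
      ∑ h (λ c → rowProfile i r ((c + (h ∸ r)) % h))  ≡⟨ ∑-rotate h (h ∸ r) (rowProfile i r) ⟩
      ∑ h (rowProfile i r)                            ∎
      where
      open ≡-Reasoning
      i = parity a
      r = ⌊ a /2⌋
      cell : ∀ j c → φ (entryAt a (unhalve j c)) ≡ φ (block (c ⊖ r) i j r)
      cell j c = cong₂ (λ c′ j′ → φ (block (c′ ⊖ r) i j′ r))
                       (⌊unhalve/2⌋ j c) (parity-unhalve j c)

    col-profile : ∀ b → ∑ n (λ a → φ (entryAt a b)) ≡ ∑ h (colProfile (parity b) ⌊ b /2⌋)
    col-profile b = begin
      ∑ n (λ a → φ (entryAt a b))                     ≡⟨ ∑-pairs h (λ a → φ (entryAt a b)) ⟩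
      ∑ h (λ r → φ (entryAt (unhalve 0ℙ r) b) ∙ φ (entryAt (unhalve 1ℙ r) b))
        ≡⟨ ∑-cong h (λ r _ → cong₂ _∙_ (cell 0ℙ r) (cell 1ℙ r)) ⟩
      ∑ h (λ r → column (c ⊖ r) r)
        ≡⟨ ∑-cong h (λ r r<h → cong (column (c ⊖ r)) (sym (⊖-involutive c r<h))) ⟩
      ∑ h (λ r → colProfile j c ((c + (h ∸ r)) % h))  ≡⟨ ∑-reflect h c (colProfile j c) ⟩
      ∑ h (colProfile j c)                            ∎
      where
      open ≡-Reasoning
      j = parity b
      c = ⌊ b /2⌋
      column : ℕ → ℕ → A
      column d r = φ (block d 0ℙ j r) ∙ φ (block d 1ℙ j r)
      cell : ∀ i r → φ (entryAt (unhalve i r) b) ≡ φ (block (c ⊖ r) i j r)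
      cell i r = cong₂ (λ r′ i′ → φ (block (c ⊖ r′) i′ j r′))
                       (⌊unhalve/2⌋ i r) (parity-unhalve i r)

    ∑-diagonals : ∀ P (Q : Parity → ℕ → A) {c t} →
      (∀ e → m + m ≤ e → P (3 + e) ≡ ε) →
      (∀ e → e < m + m → P (3 + e) ≡ Q (parity e) e) →
      (∀ p → Q 0ℙ (unhalve 0ℙ p) ∙ Q 1ℙ (unhalve 1ℙ p) ≡ c) → ∑ m (λ _ → c) ≡ t →
      ∑ h P ≡ P 0 ∙ (P 1 ∙ (P 2 ∙ t))
    ∑-diagonals P Q {c} {t} empty inside pair ∑c≡t = begin
      ∑ h P                                                ≡⟨ ∑-+ (3 + (m + m)) s P ⟩
      ∑ (3 + (m + m)) P ∙ ∑ s (λ i → P (3 + (m + m) + i))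
        ≡⟨ cong (∑ (3 + (m + m)) P ∙_) (∑-ε s (λ i _ → empty (m + m + i) (m≤m+n (m + m) i))) ⟩
      ∑ (3 + (m + m)) P ∙ ε                                ≡⟨ identityʳ _ ⟩
      P 0 ∙ (P 1 ∙ (P 2 ∙ ∑ (m + m) (λ e → P (3 + e))))
        ≡⟨ cong (λ u → P 0 ∙ (P 1 ∙ (P 2 ∙ u))) bands ⟩
      P 0 ∙ (P 1 ∙ (P 2 ∙ t))                              ∎
      where
      open ≡-Reasoning
      band-of : ∀ π {p} → p < m → P (3 + unhalve π p) ≡ Q π (unhalve π p)
      band-of π {p} p<m =
        trans (inside (unhalve π p) (unhalve-< π p<m))
              (cong (λ π′ → Q π′ (unhalve π p)) (parity-unhalve π p))
      bands : ∑ (m + m) (λ e → P (3 + e)) ≡ t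
      bands = begin
        ∑ (m + m) (λ e → P (3 + e))                              ≡⟨ ∑-pairs m (λ e → P (3 + e)) ⟩
        ∑ m (λ p → P (3 + unhalve 0ℙ p) ∙ P (3 + unhalve 1ℙ p))
          ≡⟨ ∑-cong m (λ p p<m → trans (cong₂ _∙_ (band-of 0ℙ p<m) (band-of 1ℙ p<m)) (pair p)) ⟩
        ∑ m (λ _ → c)                                            ≡⟨ ∑c≡t ⟩
        t                                                        ∎

    φ-band-outside : ∀ {e} i j r → m + m ≤ e → φ (band e i j r) ≡ ε
    φ-band-outside i j r 2m≤e = trans (cong φ (band-outside i j r 2m≤e)) φ-nothing

    φ-band-inside : ∀ {e} i j r → e < m + m →
                    φ (band e i j r) ≡ φ (just (pairBlock (parity e) i j (bandBase e r)))
    φ-band-inside i j r e<2m = cong φ (band-inside i j r e<2m)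

    row-split : ∀ i r {c t} →
                (∀ x y → pairRow 0ℙ i x ∙ pairRow 1ℙ i y ≡ c) → ∑ m (λ _ → c) ≡ t →
                ∑ h (rowProfile i r) ≡ rowProfile i r 0 ∙ (rowProfile i r 1 ∙ (rowProfile i r 2 ∙ t))
    row-split i r pair =
      ∑-diagonals (rowProfile i r) (λ π e → pairRow π i (bandBase e r)) empty inside (λ _ → pair _ _)
      where
      empty : ∀ e → m + m ≤ e → rowProfile i r (3 + e) ≡ ε
      empty e 2m≤e =
        trans (cong₂ _∙_ (φ-band-outside i 0ℙ r 2m≤e) (φ-band-outside i 1ℙ r 2m≤e)) (identityˡ ε)
      inside : ∀ e → e < m + m → rowProfile i r (3 + e) ≡ pairRow (parity e) i (bandBase e r)
      inside e e<2m = cong₂ _∙_ (φ-band-inside i 0ℙ r e<2m) (φ-band-inside i 1ℙ r e<2m)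

    col-split : ∀ j c {c′ t} →
                (∀ x y → pairCol 0ℙ j x ∙ pairCol 1ℙ j y ≡ c′) → ∑ m (λ _ → c′) ≡ t →
                ∑ h (colProfile j c) ≡ colProfile j c 0 ∙ (colProfile j c 1 ∙ (colProfile j c 2 ∙ t))
    col-split j c pair =
      ∑-diagonals (colProfile j c) (λ π e → pairCol π j (bandBase e (c ⊖ (3 + e)))) empty inside (λ _ → pair _ _)
      where
      empty : ∀ e → m + m ≤ e → colProfile j c (3 + e) ≡ ε
      empty e 2m≤e =
        trans (cong₂ _∙_ (φ-band-outside 0ℙ j _ 2m≤e) (φ-band-outside 1ℙ j _ 2m≤e)) (identityˡ ε)
      inside : ∀ e → e < m + m → colProfile j c (3 + e) ≡ pairCol (parity e) j (bandBase e (c ⊖ (3 + e)))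
      inside e e<2m = cong₂ _∙_ (φ-band-inside 0ℙ j _ e<2m) (φ-band-inside 1ℙ j _ e<2m)

  module Sums = LineProfiles ℤₚ.+-0-isCommutativeMonoid (fromMaybe (+ 0)) refl
  module Counts = LineProfiles +-0-isCommutativeMonoid occupied refl

  0<h : 0 < h
  0<h = s≤s z≤n

  1<h : 1 < h
  1<h = s≤s (s≤s z≤n)

  2<h : 2 < h
  2<h = s≤s (s≤s (s≤s z≤n))

  M : ℤ
  M = + (2 * n * k + 1)

  M≡2T+1 : M ≡ + 2 ℤ.* T ℤ.+ + 1
  M≡2T+1 = cong (λ t → t ℤ.+ + 1) (trans (cong +_ (*-assoc 2 n k)) (ℤₚ.pos-* 2 (n * k)))

  ∣-2T+1 : ∀ {v} → v ≡ + 2 ℤ.* T ℤ.+ + 1 → M ∣ℤ v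
  ∣-2T+1 v≡ = ℕ.∣-reflexive (cong ℤ.∣_∣ (trans M≡2T+1 (sym v≡)))

  ∣-0 : ∀ {v} → v ≡ + 0 → M ∣ℤ v
  ∣-0 v≡ = subst (M ∣ℤ_) (sym v≡) (ℕ._∣0 _)

  ∑-zeros : ℤ∑.∑ m (λ _ → + 0) ≡ + 0
  ∑-zeros = ℤ∑.∑-ε m (λ _ _ → refl)

  ∑-fours : ∀ q → ℕ∑.∑ q (λ _ → 4) ≡ 4 * q
  ∑-fours zero    = refl
  ∑-fours (suc q) = trans (cong (λ t → 4 + t) (∑-fours q)) (sym (*-suc 4 q))

  row-divisible : ∀ i r → M ∣ℤ ℤ∑.∑ h (Sums.rowProfile i r)
  row-divisible 0ℙ r = ∣-2T+1 (trans (Sums.row-split 0ℙ r (pairBlock-rows-cancel 0ℙ) ∑-zeros)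
                                     (row₀-sum H T (+ r) (+ prev r)))
  row-divisible 1ℙ r = ∣-0 (trans (Sums.row-split 1ℙ r (pairBlock-rows-cancel 1ℙ) ∑-zeros)
                                  (row₁-sum H T (+ r) (+ prev r)))

  col-divisible : ∀ j c → M ∣ℤ ℤ∑.∑ h (Sums.colProfile j c)
  col-divisible 0ℙ c = ∣-0 (trans (Sums.col-split 0ℙ c (pairBlock-cols-cancel 0ℙ) ∑-zeros)
                                  (col₀-sum H T (+ (c ⊖ 1)) (+ (c ⊖ 2)) prev₁ prev₂))
    where prev₁ = cong +_ (⊖-suc c 0<h)
          prev₂ = cong +_ (⊖-suc c 1<h)
  col-divisible 1ℙ c = ∣-2T+1 (trans (Sums.col-split 1ℙ c (pairBlock-cols-cancel 1ℙ) ∑-zeros)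
                                     (col₁-sum H T (+ (c ⊖ 1)) (+ (c ⊖ 2)) prev₁ prev₂))
    where prev₁ = cong +_ (⊖-suc c 0<h)
          prev₂ = cong +_ (⊖-suc c 1<h)

  row-count : ∀ i r → ℕ∑.∑ h (Counts.rowProfile i r) ≡ k
  row-count 0ℙ r = Counts.row-split 0ℙ r (λ _ _ → refl) (∑-fours m)
  row-count 1ℙ r = Counts.row-split 1ℙ r (λ _ _ → refl) (∑-fours m)

  col-count : ∀ j c → ℕ∑.∑ h (Counts.colProfile j c) ≡ k
  col-count 0ℙ c = Counts.col-split 0ℙ c (λ _ _ → refl) (∑-fours m)
  col-count 1ℙ c = Counts.col-split 1ℙ c (λ _ _ → refl) (∑-fours m)

  Occurs : ℕ → Set
  Occurs x = ∃[ a ] ∃[ b ] (array a b ≡ just (+ x) ⊎ array a b ≡ just (- (+ x)))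

  entryAt-unhalve : ∀ i j r c → entryAt (unhalve i r) (unhalve j c) ≡ block (c ⊖ r) i j r
  entryAt-unhalve i j r c
    rewrite ⌊unhalve/2⌋ i r | ⌊unhalve/2⌋ j c | parity-unhalve i r | parity-unhalve j c = refl

  occurs : ∀ {x v} d i j r → d < h → r < h → block d i j r ≡ just v → v ≡± x → Occurs x
  occurs {v = v} d i j r d<h r<h block≡v v≡±x = fromℕ< a<n , fromℕ< b<n , Sum.map via via v≡±x
    where
    open ≡-Reasoning
    c = (r + d) % h
    a<n = unhalve-< i r<h
    b<n = unhalve-< j (m%n<n (r + d) h)
    via : ∀ {w} → v ≡ w → array (fromℕ< a<n) (fromℕ< b<n) ≡ just w
    via {w} v≡w = begin
      entryAt (toℕ (fromℕ< a<n)) (toℕ (fromℕ< b<n))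
        ≡⟨ cong₂ entryAt (toℕ-fromℕ< a<n) (toℕ-fromℕ< b<n) ⟩
      entryAt (unhalve i r) (unhalve j c)  ≡⟨ entryAt-unhalve i j r c ⟩
      block (c ⊖ r) i j r                  ≡⟨ cong (λ d′ → block d′ i j r) (⊖-cancel (<⇒≤ r<h) d<h) ⟩
      block d i j r                        ≡⟨ block≡v ⟩
      just v                               ≡⟨ cong just v≡w ⟩
      just w                               ∎

  next-< : ∀ u → next u < h
  next-< u = m%n<n (1 + u) h

  prev-next : ∀ {u} → u < h → prev (next u) ≡ u
  prev-next = ⊖-cancel (s≤s z≤n)

  occurs-≤h : ∀ u → u < h → Occurs (suc u)
  occurs-≤h u u<h =
    occurs 0 1ℙ 0ℙ (next u) 0<h (next-< u) refl (inj₂ (cong (λ w → - (+ suc w)) (prev-next u<h)))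

  occurs-≤3h : ∀ x z → z < h + h → x + z ≡ 3 * h → Occurs x
  occurs-≤3h x z z<2h eq =
    at (parity z) (⌊/2⌋-< z<2h) (trans (cong (λ y → x + y) (unhalve-parity-⌊/2⌋ z)) eq)
    where
    at : ∀ j {t} → t < h → x + unhalve j t ≡ 3 * h → Occurs x
    at 0ℙ {t} t<h eq = occurs 2 1ℙ 0ℙ t 2<h t<h refl (inj₁ (minus-cast (sym (ℤₚ.pos-* 3 h)) refl eq))
    at 1ℙ {t} t<h eq = occurs 2 0ℙ 1ℙ t 2<h t<h refl (inj₁ (minus-cast (sym (ℤₚ.pos-* 3 h)) refl eq))

  occurs-≤4h : ∀ x r → r < h → x + r ≡ 4 * h → Occurs x
  occurs-≤4h x r r<h eq =
    occurs 1 0ℙ 0ℙ r 1<h r<h refl (inj₂ (cong -_ (minus-cast (sym (ℤₚ.pos-* 4 h)) refl eq)))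

  occurs-≤5h : ∀ x r → r < h → x + r ≡ 5 * h → Occurs x
  occurs-≤5h x r r<h eq =
    occurs 1 1ℙ 1ℙ r 1<h r<h refl (inj₂ (cong -_ (minus-cast (sym (ℤₚ.pos-* 5 h)) refl eq)))

  occurs-≤6h : ∀ x u → u < h → x + u ≡ 6 * h → Occurs x
  occurs-≤6h x u u<h eq = occurs 0 0ℙ 1ℙ (next u) 0<h (next-< u) refl
    (inj₁ (minus-cast (sym (ℤₚ.pos-* 6 h)) (cong +_ (prev-next u<h)) eq))

  occurs-band : ∀ e r q → e < m + m → r < h → q < 4 → Occurs (bandBase e r + q)
  occurs-band e r q e<2m r<h q<4 with pairBlock-covers (parity e) q (bandBase e r) q<4
  ... | i , j , signed = occurs (3 + e) i j r 3+e<h r<h (band-inside i j r e<2m) signed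
    where
    3+e<h : 3 + e < h
    3+e<h = ≤-trans (+-monoʳ-< 3 e<2m) (m≤m+n (3 + (m + m)) s)

  bandEnd : ℕ
  bandEnd = 6 * h + (m + m) * h * 4

  occurs-≤bandEnd : ∀ z → z < (m + m) * h * 4 → Occurs (suc (6 * h + z))
  occurs-≤bandEnd z z<w = subst Occurs (sym x≡) (occurs-band e r q e<2m (m%n<n w h) (m%n<n z 4))
    where
    open ≡-Reasoning
    q = z % 4
    w = z / 4
    r = w % h
    e = w / h
    e<2m : e < m + m
    e<2m = m<n*o⇒m/o<n (m<n*o⇒m/o<n z<w)
    shuffle : ∀ a q b → suc (a + (q + b)) ≡ suc (a + b) + q
    shuffle = solve-∀
    x≡ : suc (6 * h + z) ≡ bandBase e r + q
    x≡ = begin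
      suc (6 * h + z)
        ≡⟨ cong (λ z′ → suc (6 * h + z′)) (m≡m%n+[m/n]*n z 4) ⟩
      suc (6 * h + (q + w * 4))
        ≡⟨ cong (λ w′ → suc (6 * h + (q + w′ * 4))) (m≡m%n+[m/n]*n w h) ⟩
      suc (6 * h + (q + (r + e * h) * 4))
        ≡⟨ shuffle (6 * h) q ((r + e * h) * 4) ⟩
      bandBase e r + q
        ∎

  nk≡ : n * k ≡ bandEnd + h + h + h + h
  nk≡ = expand h m
    where
    expand : ∀ h m → (h + h) * (5 + 4 * m) ≡ 6 * h + (m + m) * h * 4 + h + h + h + h
    expand = solve-∀

  occurs-≤nk-3h : ∀ x u → u < h → x + u ≡ bandEnd + h → Occurs x
  occurs-≤nk-3h x u u<h eq = occurs 1 1ℙ 0ℙ (next u) 1<h (next-< u) refl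
    (inj₂ (cong -_ (minus-cast refl (cong₂ ℤ._+_ (sym (ℤₚ.pos-* 3 h)) (cong +_ (prev-next u<h))) x≡)))
    where
    shuffle : ∀ x u h → x + (3 * h + u) ≡ x + u + h + h + h
    shuffle = solve-∀
    x≡ : x + (3 * h + u) ≡ n * k
    x≡ = trans (shuffle x u h) (trans (cong (λ t → t + h + h + h) eq) (sym nk≡))

  occurs-≤nk-2h : ∀ u → u < h → Occurs (suc (bandEnd + h + u))
  occurs-≤nk-2h u u<h = occurs 1 0ℙ 1ℙ (next u) 1<h (next-< u) refl
    (inj₁ (minus-cast (cong (λ w → T ℤ.+ + 1 ℤ.+ + w) (prev-next u<h)) (sym (ℤₚ.pos-* 3 h)) x≡))
    where
    shuffle : ∀ E h u → suc (E + h + u) + 3 * h ≡ E + h + h + h + h + 1 + u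
    shuffle = solve-∀
    x≡ : suc (bandEnd + h + u) + 3 * h ≡ n * k + 1 + u
    x≡ = trans (shuffle bandEnd h u) (cong (λ t → t + 1 + u) (sym nk≡))

  occurs-≤nk-h : ∀ r → r < h → Occurs (suc (bandEnd + h + h + r))
  occurs-≤nk-h r r<h = occurs 2 0ℙ 0ℙ r 2<h r<h refl (inj₁ (minus-cast refl (sym (ℤₚ.pos-* 2 h)) x≡))
    where
    shuffle : ∀ E h r → suc (E + h + h + r) + 2 * h ≡ E + h + h + h + h + 1 + r
    shuffle = solve-∀
    x≡ : suc (bandEnd + h + h + r) + 2 * h ≡ n * k + 1 + r
    x≡ = trans (shuffle bandEnd h r) (cong (λ t → t + 1 + r) (sym nk≡))

  occurs-≤nk : ∀ r → r < h → Occurs (suc (bandEnd + h + h + h + r))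
  occurs-≤nk r r<h = occurs 2 1ℙ 1ℙ r 2<h r<h refl (inj₁ (minus-cast refl refl x≡))
    where
    shuffle : ∀ E h r → suc (E + h + h + h + r) + h ≡ E + h + h + h + h + 1 + r
    shuffle = solve-∀
    x≡ : suc (bandEnd + h + h + h + r) + h ≡ n * k + 1 + r
    x≡ = trans (shuffle bandEnd h r) (cong (λ t → t + 1 + r) (sym nk≡))

  open Intervals Occurs

  cover : Covered 0 (n * k)
  cover = covered-ascending refl occurs-≤h
       ++ covered-descending 3h≡ occurs-≤3h
       ++ covered-descending (+-comm (3 * h) h) occurs-≤4h
       ++ covered-descending (+-comm (4 * h) h) occurs-≤5h
       ++ covered-descending (+-comm (5 * h) h) occurs-≤6h
       ++ covered-ascending refl occurs-≤bandEnd
       ++ covered-descending refl occurs-≤nk-3h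
       ++ covered-ascending refl occurs-≤nk-2h
       ++ covered-ascending refl occurs-≤nk-h
       ++ covered-ascending (sym nk≡) occurs-≤nk
    where
    3h≡ : h + (h + h) ≡ 3 * h
    3h≡ = cong (λ t → h + (h + t)) (sym (+-identityʳ h))

  heffter : HeffterArray n k
  heffter = array , record
    { rowFilled = λ a → trans (filledCount-∑ n (entryAt (toℕ a))) (rowFilled (toℕ a))
    ; colFilled = λ b → trans (filledCount-∑ n (λ a → entryAt a (toℕ b))) (colFilled (toℕ b))
    ; rowSum    = λ a → subst (M ∣ℤ_) (sym (lineSum-∑ n (entryAt (toℕ a)))) (rowSum (toℕ a))
    ; colSum    = λ b → subst (M ∣ℤ_) (sym (lineSum-∑ n (λ a → entryAt a (toℕ b)))) (colSum (toℕ b))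
    ; covers    = cover
    }
    where
    rowFilled : ∀ a → ℕ∑.∑ n (occupied ∘ entryAt a) ≡ k
    rowFilled a = trans (Counts.row-profile a) (row-count (parity a) ⌊ a /2⌋)
    colFilled : ∀ b → ℕ∑.∑ n (λ a → occupied (entryAt a b)) ≡ k
    colFilled b = trans (Counts.col-profile b) (col-count (parity b) ⌊ b /2⌋)
    rowSum : ∀ a → M ∣ℤ ℤ∑.∑ n (fromMaybe (+ 0) ∘ entryAt a)
    rowSum a = subst (M ∣ℤ_) (sym (Sums.row-profile a)) (row-divisible (parity a) ⌊ a /2⌋)
    colSum : ∀ b → M ∣ℤ ℤ∑.∑ n (λ a → fromMaybe (+ 0) (entryAt a b))
    colSum b = subst (M ∣ℤ_) (sym (Sums.col-profile b)) (col-divisible (parity b) ⌊ b /2⌋)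

module Existence where

  open import Data.Nat using (suc; _+_; _*_; _∸_; _/_; s≤s)
  open import Data.Nat.Properties
  open import Data.Nat.DivMod using (m≡m%n+[m/n]*n)
  open import Data.Nat.Tactic.RingSolver using (solve-∀)

  heffter-2h : ∀ h m → 3 + (m + m) ≤ h → HeffterArray (h + h) (5 + 4 * m)
  heffter-2h h m 3+2m≤h =
    subst (λ h′ → HeffterArray (h′ + h′) (5 + 4 * m)) (m+[n∸m]≡n 3+2m≤h)
          (Construction.heffter m (h ∸ (3 + (m + m))))

  heffter-mod4 : ∀ q r → 0 < r → r ≤ q → HeffterArray (2 + q * 4) (1 + r * 4)
  heffter-mod4 q (suc m) _ m<q = subst₂ HeffterArray (n≡ q) (k≡ m) (heffter-2h (suc (q + q)) m bound)
    where
    n≡ : ∀ q → suc (q + q) + suc (q + q) ≡ 2 + q * 4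
    n≡ = solve-∀
    k≡ : ∀ m → 5 + 4 * m ≡ 1 + suc m * 4
    k≡ = solve-∀
    bound : 3 + (m + m) ≤ suc (q + q)
    bound = subst (_≤ suc (q + q)) (cong (suc ∘ suc) (+-suc m m)) (s≤s (+-mono-≤ m<q m<q))

  a%4≡r⇒a≡r+[a/4]*4 : ∀ {a r} → a % 4 ≡ r → a ≡ r + a / 4 * 4
  a%4≡r⇒a≡r+[a/4]*4 {a} refl = m≡m%n+[m/n]*n a 4

theorem7p2 : ∀ (n k : ℕ) → n % 4 ≡ 2 → 6 ≤ n → k % 4 ≡ 1 → 5 ≤ k → k < n →
    HeffterArray n k
theorem7p2 n k n%4≡2 _ k%4≡1 5≤k k<n =
  subst₂ HeffterArray (sym (a%4≡r⇒a≡r+[a/4]*4 n%4≡2)) (sym (a%4≡r⇒a≡r+[a/4]*4 k%4≡1))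
         (heffter-mod4 (n / 4) (k / 4) 0<k/4 k/4≤n/4)
  where
  open Existence
  open import Data.Nat using (_/_)
  open import Data.Nat.Properties using (≤-trans; n≤1+n; <⇒≤)
  open import Data.Nat.DivMod using (m≥n⇒m/n>0; /-monoˡ-≤)
  0<k/4 : 0 < k / 4
  0<k/4 = m≥n⇒m/n>0 (≤-trans (n≤1+n 4) 5≤k)
  k/4≤n/4 : k / 4 ≤ n / 4
  k/4≤n/4 = /-monoˡ-≤ 4 (<⇒≤ k<n)
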